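{- Let $G$ be a graph, let $F$ be a $k$-flip on $V(G)$, and let $I$ be an independent set of $G$. Then there exists a $2k2^{2k}$-flip $F'$ on $V(G)$ such that for all $x,y\in V(G)$, $\mathrm{dist}_{G\ast I\oplus F'}(x,y)\ge\frac12\,\mathrm{dist}_{G\oplus F}(x,y)$.
   Context: Graphs are finite and simple; adjacency $E_G(u,v)\in\mathrm{GF}(2)$; distances may be infinite. A $k$-flip on $V$ is $F=(\iota,\tau)$ with $\iota:V\to[k]$ and $\tau:[k]\times[k]\to\mathrm{GF}(2)$ symmetric; $G\oplus F$ has $E_{G\oplus F}(x,y)=E_G(x,y)+\tau(\iota(x),\iota(y))$ for distinct $x,y$. For an independent set $I$, $E_{G\ast I}(x,y)=E_G(x,y)+\sum_{v\in I}E_G(x,v)E_G(v,y)$ (successive local complementation of the vertices of $I$). Expressions are evaluated left to right: $G\ast I\oplus F'=(G\ast I)\oplus F'$. -}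

module Defs where

open import Data.Nat using (ℕ; zero; suc; _+_; _*_; _^_; _≤_)
open import Data.Fin using (Fin; zero; suc)
open import Data.Bool using (Bool; true; false; _xor_; _∧_)
open import Data.Product using (Σ; _×_; ∃-syntax)
open import Relation.Binary.PropositionalEquality using (_≡_; _≢_)

-- GF(2) is represented by Bool, with + = xor and · = ∧.

Adj : ℕ → Set
Adj n = Fin n → Fin n → Bool

record Graph (n : ℕ) : Set where
  field
    E     : Adj n
    sym   : ∀ x y → E x y ≡ E y x
    irrefl : ∀ x → E x x ≡ false
open Graph public

record Flip (n k : ℕ) : Set where
  field
    ι    : Fin n → Fin k
    τ    : Fin k → Fin k → Bool
    τsym : ∀ a b → τ a b ≡ τ b a
open Flip public

-- G ⊕ F  (value on the diagonal irrelevant: adjacency only for distinct vertices)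
_⊕_ : ∀ {n k} → Adj n → Flip n k → Adj n
(E ⊕ F) x y = E x y xor τ F (ι F x) (ι F y)

Σ₂ : ∀ {n} → (Fin n → Bool) → Bool
Σ₂ {zero}  f = false
Σ₂ {suc n} f = f zero xor Σ₂ {n} (λ i → f (suc i))

Subset : ℕ → Set
Subset n = Fin n → Bool

Independent : ∀ {n} → Graph n → Subset n → Set
Independent G I = ∀ u v → I u ≡ true → I v ≡ true → E G u v ≡ false

_∗_ : ∀ {n} → Adj n → Subset n → Adj n
(E ∗ I) x y = E x y xor Σ₂ (λ v → I v ∧ (E x v ∧ E v y))

Adjacent : ∀ {n} → Adj n → Fin n → Fin n → Set
Adjacent E x y = (x ≢ y) × (E x y ≡ true)

data Walk {n} (E : Adj n) : Fin n → Fin n → ℕ → Set where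
  here : ∀ {x} → Walk E x x zero
  step : ∀ {x y z d} → Adjacent E x y → Walk E y z d → Walk E x z (suc d)

-- dist_E(x,y) ≤ d   (distances may be infinite: then this never holds)
Dist≤ : ∀ {n} → Adj n → Fin n → Fin n → ℕ → Set
Dist≤ E x y d = ∃[ d' ] (d' ≤ d × Walk E x y d')

{-# OPTIONS --safe #-}
-- Over GF(2) write T for the adjacency matrix of the flip F and A·B for A · diag(I) · B.
-- Expanding gives (G ⊕ F) ∗ I = G ∗ I + (T + G·T + T·G + T·T). As T is constant on the
-- classes of F, (G·T)(x, y) = β x (ι y) for a row β x ∈ GF(2)^k, and by symmetry
-- (T·G)(x, y) = β y (ι x). So the bracket is a flip F′ on the classes (ι x, β x), of which
-- there are at most k·2^k, and (G ∗ I) ⊕ F′ = (G ⊕ F) ∗ I. An edge of the latter is an edge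
-- of G ⊕ F or joins the ends of a path of length two in it, so distances at most halve.
module Submission where

open import Defs
open import Algebra.Bundles using (CommutativeRing)
open import Data.Bool using (Bool; true; false; _xor_; _∧_)
open import Data.Bool.Properties
  using (xor-∧-commutativeRing; xor-assoc; ∧-comm; ∧-distribˡ-xor; ∧-distribʳ-xor)
open import Data.Fin
  using (Fin; zero; suc; _↑ˡ_; splitAt; combine; remQuot; finToFun; funToFin)
open import Data.Fin.Properties
  using (splitAt-↑ˡ; remQuot-combine; finToFun-funToFin; 2↔Bool)
open import Data.Nat using (ℕ; suc; _+_; _*_; _^_; _≤_; z≤n; s≤s)
open import Data.Nat.Properties
  using ( ≤-trans; ≤-reflexive; +-mono-≤; *-mono-≤; *-monoʳ-≤; *-suc; m≤n*m; ^-monoʳ-≤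
        ; m≤n⇒∃[o]m+o≡n)
open import Data.Product using (Σ; _×_; _,_; proj₁; proj₂; ∃-syntax)
import Data.Product as Product
open import Data.Sum using (_⊎_; inj₁; inj₂)
open import Function using (_∘_; id)
open import Function.Bundles using (Inverse)
open import Relation.Binary.PropositionalEquality
  using (_≡_; _≢_; _≗_; refl; trans; cong; cong₂; module ≡-Reasoning)
  renaming (sym to ≡-sym)

open import Algebra.Properties.CommutativeSemigroup
  (CommutativeRing.+-commutativeSemigroup xor-∧-commutativeRing)
  using (interchange; x∙yz≈y∙xz)

Σ₂-cong : ∀ {n} {f g : Fin n → Bool} → f ≗ g → Σ₂ f ≡ Σ₂ g
Σ₂-cong {0}     f≗g = refl
Σ₂-cong {suc n} f≗g = cong₂ _xor_ (f≗g zero) (Σ₂-cong (f≗g ∘ suc))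

Σ₂-distrib-xor : ∀ {n} (f g : Fin n → Bool) → Σ₂ (λ v → f v xor g v) ≡ Σ₂ f xor Σ₂ g
Σ₂-distrib-xor {0}     f g = refl
Σ₂-distrib-xor {suc n} f g = trans
  (cong ((f zero xor g zero) xor_) (Σ₂-distrib-xor (f ∘ suc) (g ∘ suc)))
  (interchange (f zero) (g zero) (Σ₂ (f ∘ suc)) (Σ₂ (g ∘ suc)))

Σ₂≡true⇒∃ : ∀ {n} (f : Fin n → Bool) → Σ₂ f ≡ true → ∃[ v ] f v ≡ true
Σ₂≡true⇒∃ {suc n} f Σf≡true with f zero in f0≡true
... | true  = zero , f0≡true
... | false = Product.map suc id (Σ₂≡true⇒∃ (f ∘ suc) Σf≡true)

_·[_]_ : ∀ {n} → Adj n → Subset n → Adj n → Adj n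
(A ·[ I ] B) x y = Σ₂ (λ v → I v ∧ (A x v ∧ B v y))

_+ᴬ_ : ∀ {n} → Adj n → Adj n → Adj n
(A +ᴬ B) x y = A x y xor B x y

flipAdj : ∀ {n k} → Flip n k → Adj n
flipAdj F x y = τ F (ι F x) (ι F y)

Symmetric : ∀ {n} → Adj n → Set
Symmetric A = ∀ x y → A x y ≡ A y x

flipAdj-symmetric : ∀ {n k} (F : Flip n k) → Symmetric (flipAdj F)
flipAdj-symmetric F x y = τsym F (ι F x) (ι F y)

module _ {n} (I : Subset n) where

  ·-distribʳ-+ᴬ : ∀ (A B C : Adj n) x y →
    ((A +ᴬ B) ·[ I ] C) x y ≡ (A ·[ I ] C) x y xor (B ·[ I ] C) x y
  ·-distribʳ-+ᴬ A B C x y = trans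
    (Σ₂-cong λ v → trans (cong (I v ∧_) (∧-distribʳ-xor (C v y) (A x v) (B x v)))
                         (∧-distribˡ-xor (I v) (A x v ∧ C v y) (B x v ∧ C v y)))
    (Σ₂-distrib-xor (λ v → I v ∧ (A x v ∧ C v y)) (λ v → I v ∧ (B x v ∧ C v y)))

  ·-distribˡ-+ᴬ : ∀ (A B C : Adj n) x y →
    (A ·[ I ] (B +ᴬ C)) x y ≡ (A ·[ I ] B) x y xor (A ·[ I ] C) x y
  ·-distribˡ-+ᴬ A B C x y = trans
    (Σ₂-cong λ v → trans (cong (I v ∧_) (∧-distribˡ-xor (A x v) (B v y) (C v y)))
                         (∧-distribˡ-xor (I v) (A x v ∧ B v y) (A x v ∧ C v y)))
    (Σ₂-distrib-xor (λ v → I v ∧ (A x v ∧ B v y)) (λ v → I v ∧ (A x v ∧ C v y)))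

  ·-transpose : ∀ {A B : Adj n} → Symmetric A → Symmetric B → ∀ x y →
    (A ·[ I ] B) x y ≡ (B ·[ I ] A) y x
  ·-transpose {A} {B} symA symB x y = Σ₂-cong λ v →
    cong (I v ∧_) (trans (∧-comm (A x v) (B v y)) (cong₂ _∧_ (symB v y) (symA x v)))

Class : ℕ → Set
Class k = Fin k × (Fin k → Bool)

encodeClass : ∀ {k} → Class k → Fin (k * 2 ^ k)
encodeClass (i , b) = combine i (funToFin (Inverse.from 2↔Bool ∘ b))

decodeClass : ∀ {k} → Fin (k * 2 ^ k) → Class k
decodeClass {k} c = Product.map₂ (λ r → Inverse.to 2↔Bool ∘ finToFun r) (remQuot (2 ^ k) c)

decodeClass-encodeClass₁ : ∀ {k} (i : Fin k) b → proj₁ (decodeClass (encodeClass (i , b))) ≡ i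
decodeClass-encodeClass₁ i b = cong proj₁ (remQuot-combine i _)

decodeClass-encodeClass₂ : ∀ {k} (i : Fin k) b → proj₂ (decodeClass (encodeClass (i , b))) ≗ b
decodeClass-encodeClass₂ {k} i b j = begin
  to (finToFun (proj₂ (remQuot {k} (2 ^ k) (combine i r))) j)
    ≡⟨ cong (λ q → to (finToFun (proj₂ q) j)) (remQuot-combine i r) ⟩
  to (finToFun r j)
    ≡⟨ cong to (finToFun-funToFin (from ∘ b) j) ⟩
  to (from (b j))
    ≡⟨ Inverse.strictlyInverseˡ 2↔Bool (b j) ⟩
  b j
    ∎
  where
  open ≡-Reasoning
  open Inverse 2↔Bool using (to; from)
  r : Fin (2 ^ k)
  r = funToFin (from ∘ b)

module Correction {n k} (B : Adj n) (F : Flip n k) (I : Subset n) where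

  β : Fin n → Fin k → Bool
  β x j = Σ₂ (λ v → I v ∧ (B x v ∧ τ F (ι F v) j))

  γ : Fin k → Fin k → Bool
  γ i j = Σ₂ (λ v → I v ∧ (τ F i (ι F v) ∧ τ F (ι F v) j))

  γ-sym : ∀ i j → γ i j ≡ γ j i
  γ-sym i j = Σ₂-cong λ v → cong (I v ∧_)
    (trans (∧-comm (τ F i (ι F v)) _) (cong₂ _∧_ (τsym F (ι F v) j) (τsym F i (ι F v))))

  τᶜ : Class k → Class k → Bool
  τᶜ (i , b) (j , c) = τ F i j xor (b j xor (c i xor γ i j))

  τᶜ-sym : ∀ p q → τᶜ p q ≡ τᶜ q p
  τᶜ-sym (i , b) (j , c) = cong₂ _xor_ (τsym F i j)
    (trans (x∙yz≈y∙xz (b j) (c i) (γ i j)) (cong (λ g → c i xor (b j xor g)) (γ-sym i j)))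

  τᶜ-cong : ∀ {i i′ j j′ b b′ c c′} → i ≡ i′ → j ≡ j′ → b ≗ b′ → c ≗ c′ →
    τᶜ (i , b) (j , c) ≡ τᶜ (i′ , b′) (j′ , c′)
  τᶜ-cong {i} {j = j} refl refl b≗b′ c≗c′ =
    cong₂ (λ u w → τ F i j xor (u xor (w xor γ i j))) (b≗b′ j) (c≗c′ i)

  τᶜ-decode-encode : ∀ p q →
    τᶜ (decodeClass (encodeClass p)) (decodeClass (encodeClass q)) ≡ τᶜ p q
  τᶜ-decode-encode (i , b) (j , c) = τᶜ-cong
    (decodeClass-encodeClass₁ i b) (decodeClass-encodeClass₁ j c)
    (decodeClass-encodeClass₂ i b) (decodeClass-encodeClass₂ j c)

  correctionFlip : Flip n (k * 2 ^ k)
  correctionFlip = record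
    { ι    = λ x → encodeClass (ι F x , β x)
    ; τ    = λ a b → τᶜ (decodeClass a) (decodeClass b)
    ; τsym = λ a b → τᶜ-sym (decodeClass a) (decodeClass b)
    }

  flipAdj-correctionFlip : Symmetric B → ∀ x y → let T = flipAdj F in
    flipAdj correctionFlip x y ≡
      T x y xor ((B ·[ I ] T) x y xor ((T ·[ I ] B) x y xor (T ·[ I ] T) x y))
  flipAdj-correctionFlip symB x y = trans
    (τᶜ-decode-encode (ι F x , β x) (ι F y , β y))
    (cong (λ u → τ F (ι F x) (ι F y) xor (β x (ι F y) xor (u xor γ (ι F x) (ι F y))))
          (·-transpose I symB (flipAdj-symmetric F) y x))

open Correction using (correctionFlip; flipAdj-correctionFlip)

∗-⊕-correction : ∀ {n k} {B : Adj n} → Symmetric B → (F : Flip n k) (I : Subset n) →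
  ∀ x y → ((B ⊕ F) ∗ I) x y ≡ ((B ∗ I) ⊕ correctionFlip B F I) x y
∗-⊕-correction {B = B} symB F I x y = begin
  (b xor t) xor ((B +ᴬ T) ·[ I ] (B +ᴬ T)) x y
    ≡⟨ cong ((b xor t) xor_) expand ⟩
  (b xor t) xor ((BB xor BT) xor (TB xor TT))
    ≡⟨ cong ((b xor t) xor_) (xor-assoc BB BT (TB xor TT)) ⟩
  (b xor t) xor (BB xor (BT xor (TB xor TT)))
    ≡⟨ interchange b t BB (BT xor (TB xor TT)) ⟩
  (b xor BB) xor (t xor (BT xor (TB xor TT)))
    ≡⟨ cong ((b xor BB) xor_) (flipAdj-correctionFlip B F I symB x y) ⟨
  ((B ∗ I) ⊕ correctionFlip B F I) x y
    ∎
  where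
  open ≡-Reasoning
  T : Adj _
  T = flipAdj F
  b t BB BT TB TT : Bool
  b  = B x y
  t  = T x y
  BB = (B ·[ I ] B) x y
  BT = (B ·[ I ] T) x y
  TB = (T ·[ I ] B) x y
  TT = (T ·[ I ] T) x y
  expand : ((B +ᴬ T) ·[ I ] (B +ᴬ T)) x y ≡ (BB xor BT) xor (TB xor TT)
  expand = trans (·-distribʳ-+ᴬ I B T (B +ᴬ T) x y)
                 (cong₂ _xor_ (·-distribˡ-+ᴬ I B B T x y) (·-distribˡ-+ᴬ I T B T x y))

liftInj₁ : ∀ {A C : Set} → (A → A → Bool) → A ⊎ C → A ⊎ C → Bool
liftInj₁ R (inj₁ a) (inj₁ a′) = R a a′
liftInj₁ R _        _         = false

liftInj₁-sym : ∀ {A C : Set} {R : A → A → Bool} → (∀ a a′ → R a a′ ≡ R a′ a) →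
  ∀ p q → liftInj₁ {C = C} R p q ≡ liftInj₁ R q p
liftInj₁-sym symR (inj₁ a) (inj₁ a′) = symR a a′
liftInj₁-sym symR (inj₁ a) (inj₂ _)  = refl
liftInj₁-sym symR (inj₂ _) (inj₁ _)  = refl
liftInj₁-sym symR (inj₂ _) (inj₂ _)  = refl

extend : ∀ {n m} r → Flip n m → Flip n (m + r)
extend {m = m} r F = record
  { ι    = λ x → ι F x ↑ˡ r
  ; τ    = λ a b → liftInj₁ (τ F) (splitAt m a) (splitAt m b)
  ; τsym = λ a b → liftInj₁-sym (τsym F) (splitAt m a) (splitAt m b)
  }

⊕-extend : ∀ {n m} r (F : Flip n m) (A : Adj n) x y → (A ⊕ extend r F) x y ≡ (A ⊕ F) x y
⊕-extend {m = m} r F A x y = cong₂ (λ p q → A x y xor liftInj₁ (τ F) p q)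
  (splitAt-↑ˡ m (ι F x) r) (splitAt-↑ˡ m (ι F y) r)

widen : ∀ {n m M} → m ≤ M → Flip n m → Flip n M
widen m≤M F with m≤n⇒∃[o]m+o≡n m≤M
... | r , refl = extend r F

⊕-widen : ∀ {n m M} (m≤M : m ≤ M) (F : Flip n m) (A : Adj n) x y →
  (A ⊕ widen m≤M F) x y ≡ (A ⊕ F) x y
⊕-widen m≤M F A x y with m≤n⇒∃[o]m+o≡n m≤M
... | r , refl = ⊕-extend r F A x y

_++ʷ_ : ∀ {n} {A : Adj n} {x y z a b} → Walk A x y a → Walk A y z b → Walk A x z (a + b)
here     ++ʷ w′ = w′
step e w ++ʷ w′ = step e (w ++ʷ w′)

Dist≤-trans : ∀ {n} {A : Adj n} {x y z a b} →
  Dist≤ A x y a → Dist≤ A y z b → Dist≤ A x z (a + b)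
Dist≤-trans (a′ , a′≤a , w) (b′ , b′≤b , w′) = a′ + b′ , +-mono-≤ a′≤a b′≤b , w ++ʷ w′

Dist≤-mono : ∀ {n} {A : Adj n} {x y a b} → a ≤ b → Dist≤ A x y a → Dist≤ A x y b
Dist≤-mono a≤b (a′ , a′≤a , w) = a′ , ≤-trans a′≤a a≤b , w

Walk⇒Dist≤-stretch : ∀ {n} {A B : Adj n} {c} →
  (∀ {u v} → Adjacent A u v → Dist≤ B u v c) →
  ∀ {x y d} → Walk A x y d → Dist≤ B x y (c * d)
Walk⇒Dist≤-stretch edge here = 0 , z≤n , here
Walk⇒Dist≤-stretch {c = c} edge {d = suc d} (step e w) =
  Dist≤-mono (≤-reflexive (≡-sym (*-suc c d)))
             (Dist≤-trans (edge e) (Walk⇒Dist≤-stretch edge w))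

Dist≤-stretch : ∀ {n} {A B : Adj n} {c} →
  (∀ {u v} → Adjacent A u v → Dist≤ B u v c) →
  ∀ {x y d} → Dist≤ A x y d → Dist≤ B x y (c * d)
Dist≤-stretch {c = c} edge (d′ , d′≤d , w) =
  Dist≤-mono (*-monoʳ-≤ c d′≤d) (Walk⇒Dist≤-stretch edge w)

∧≡true⇒× : ∀ a {b} → a ∧ b ≡ true → a ≡ true × b ≡ true
∧≡true⇒× true {true} refl = refl , refl

∗-Adjacent⇒Dist≤2 : ∀ {n} (A : Adj n) (I : Subset n) {x y} →
  Adjacent (A ∗ I) x y → Dist≤ A x y 2
∗-Adjacent⇒Dist≤2 A I {x} {y} (x≢y , e) with A x y in Axy
... | true  = 1 , s≤s z≤n , step (x≢y , Axy) here
... | false with Σ₂≡true⇒∃ _ e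
...   | v , p with ∧≡true⇒× (I v) p
...     | _ , q with ∧≡true⇒× (A x v) q
...       | Axv , Avy = 2 , s≤s (s≤s z≤n) , step (x≢v , Axv) (step (v≢y , Avy) here)
  where
  x≢v : x ≢ v
  x≢v refl with () ← trans (≡-sym Axy) Avy
  v≢y : v ≢ y
  v≢y refl with () ← trans (≡-sym Axy) Axv

classCount≤ : ∀ k → k * 2 ^ k ≤ 2 * k * 2 ^ (2 * k)
classCount≤ k = *-mono-≤ (m≤n*m k 2) (^-monoʳ-≤ 2 (m≤n*m k 2))

lemma10 : ∀ {n k} (G : Graph n) (F : Flip n k) (I : Subset n) → Independent G I →
    Σ (Flip n (2 * k * 2 ^ (2 * k))) (λ F′ → ∀ (x y : Fin n) (d : ℕ) →
      Dist≤ ((E G ∗ I) ⊕ F′) x y d → Dist≤ (E G ⊕ F) x y (2 * d))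
lemma10 {n} {k} G F I _ = F′ , λ x y d → Dist≤-stretch edge
  where
  F′ : Flip n (2 * k * 2 ^ (2 * k))
  F′ = widen (classCount≤ k) (correctionFlip (E G) F I)

  edge : ∀ {u v} → Adjacent ((E G ∗ I) ⊕ F′) u v → Dist≤ (E G ⊕ F) u v 2
  edge {u} {v} (u≢v , e) = ∗-Adjacent⇒Dist≤2 (E G ⊕ F) I (u≢v , (begin
    ((E G ⊕ F) ∗ I) u v                        ≡⟨ ∗-⊕-correction (sym G) F I u v ⟩
    ((E G ∗ I) ⊕ correctionFlip (E G) F I) u v ≡⟨ ⊕-widen (classCount≤ k) _ (E G ∗ I) u v ⟨
    ((E G ∗ I) ⊕ F′) u v                       ≡⟨ e ⟩
    true                                       ∎))
    where open ≡-Reasoning
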